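{- Let $a,b\in\mathbf{V}$, let $f:a\to b$ be a function in $\mathbf{V}$, and let $\hat f=\{(\mathrm{op}(\mathfrak{r}(c),\mathfrak{r}(f(c))),\pi):c\in a,\ \pi\in\Pi\}$. Then $\lambda u.\lambda v.vu\Vdash\forall x^{\mathfrak{r}(a)}\,\forall y\,\forall y'\,(y\neq y'\to(\mathrm{op}(x,y)\,\varepsilon\,\hat f\to\mathrm{op}(x,y')\not\varepsilon\,\hat f))$. Therefore $\hat f$ is realized to be an $\varepsilon$-function with domain $\mathfrak{r}(a)$.
   Context: Setting (Krivine realizability) over a model $\mathbf{V}$ of ZF with realizability algebra $(\Lambda,\Pi,\succ,\perp\!\!\!\perp)$: $\Lambda$ closed $\lambda_c$-terms (variables, application, abstraction, $\mathsf{cc}$, continuation constants $\mathsf{k}_\pi$, possibly special instructions), $\Pi$ stacks (stack bottoms and $t\cdot\pi$), $\succ$ a preorder on processes containing $ts\star\pi\succ t\star s\cdot\pi$, $\lambda u.t\star s\cdot\pi\succ t[u:=s]\star\pi$, $\mathsf{cc}\star t\cdot\pi\succ t\star\mathsf{k}_\pi\cdot\pi$, $\mathsf{k}_\sigma\star t\cdot\pi\succ t\star\sigma$; pole $\perp\!\!\!\perp$ closed under anti-reduction. Church numerals $\underline0=\lambda u.\lambda v.v$, $\underline1=\lambda u.\lambda v.uv$. Names $\mathbf{N}=\bigcup_\alpha\mathbf{N}_\alpha$, $\mathbf{N}_\alpha=\bigcup_{\beta<\alpha}\mathcal{P}(\mathbf{N}_\beta\times\Pi)$, $\mathrm{dom}(a)=\{b:\exists\pi(b,\pi)\in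 a\}$. Falsity values of closed formulas with parameters in $\mathbf{N}$: $\|\perp\|=\Pi$, $\|a\not\varepsilon b\|=\{\pi:(a,\pi)\in b\}$, $\|a\neq b\|=\Pi$ if $a,b$ are the same set and $\emptyset$ otherwise, $\|\varphi\to\psi\|=\{t\cdot\pi:t\Vdash\varphi,\pi\in\|\psi\|\}$, $\|\forall x\varphi\|=\bigcup_{a\in\mathbf{N}}\|\varphi(a)\|$, restricted quantifier $\|\forall x^{c}\varphi(x)\|=\bigcup_{d\in\mathrm{dom}(c)}\|\varphi(d)\|$; $t\Vdash\varphi$ iff $t\star\pi\in\perp\!\!\!\perp$ for all $\pi\in\|\varphi\|$; "realized" means realized by some realizer (term without continuation constants). Abbreviations: $\neg\varphi:=\varphi\to\perp$, $a\,\varepsilon\,b:=a\not\varepsilon b\to\perp$, $a=b:=a\neq b\to\perp$, $\varphi\wedge\psi:=(\varphi\to(\psi\to\perp))\to\perp$, $\exists x\varphi:=\forall x(\varphi\to\perp)\to\perp$, $\forall x\,\varepsilon\,c\,\varphi:=\forall x(\neg\varphi(x)\to x\not\varepsilon c)$. An $\varepsilon$-function with domain $c$ is a set $g$ with $\forall x\,\varepsilon\,c\,\exists y\,\mathrm{op}(x,y)\,\varepsilon\,g$ and $\forall x\,\varepsilon\,c\,\forall y,y'(\mathrm{op}(x,y)\,\varepsilon\,g\wedge\mathrm{op}(x,y')\,\varepsilon\,g\to y=y')$. Reish: $\mathfrak{r}(x)=\{(\mathfrak{r}(y),\pi):y\in x,\pi\in\Pi\}$. Operations: $\mathrm{sng}(a)=\{a\}\times\Pi$;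 $\mathrm{up}(a,b)=\{(a,\underline0\cdot\pi):\pi\in\Pi\}\cup\{(b,\underline1\cdot\pi):\pi\in\Pi\}$; $\mathrm{op}(a,b)=\mathrm{up}(\mathrm{up}(\mathrm{sng}(a),\mathfrak{r}(0)),\mathrm{sng}(\mathrm{sng}(b)))$; evaluated on parameters in $\mathbf{V}$. -}

module Defs where

import Level
open import Level using (Level; Lift; lift) renaming (suc to lsuc)
open import Data.Nat using (ℕ; zero; suc)
open import Data.Fin using (Fin; zero; suc)
open import Data.Bool using (Bool; true; false)
open import Data.Empty using (⊥; ⊥-elim)
open import Data.Unit using (⊤)
open import Data.Product using (Σ; _×_; _,_; proj₁; proj₂)
open import Relation.Binary.PropositionalEquality using (_≡_)

-- The ground model V: iterative (Aczel-style) well-founded sets,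
-- with extensional equality and membership.

data V : Set₁ where
  sup : (I : Set) → (I → V) → V

Idx : V → Set
Idx (sup I _) = I

elt : (a : V) → Idx a → V
elt (sup _ f) = f

_≈V_ : V → V → Set
sup I f ≈V sup J g =
  ((i : I) → Σ J λ j → f i ≈V g j) × ((j : J) → Σ I λ i → f i ≈V g j)

_∈V_ : V → V → Set
c ∈V sup I f = Σ I λ i → f i ≈V c

emptyV : V
emptyV = sup ⊥ ⊥-elim

-- Krivine realizability, parametrised by the set of special
-- instructions and the set of stack bottoms.

module K (Inst Bot : Set) where

  infixr 5 _∙_

  mutual
    data Term : ℕ → Set where
      var : ∀ {n} → Fin n → Term n
      app : ∀ {n} → Term n → Term n → Term n
      lam : ∀ {n} → Term (suc n) → Term n
      cc  : ∀ {n} → Term n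
      kk  : ∀ {n} → Stack → Term n
      ins : ∀ {n} → Inst → Term n

    data Stack : Set where
      bot : Bot → Stack
      _∙_ : Term 0 → Stack → Stack

  Λ : Set
  Λ = Term 0

  Π : Set
  Π = Stack

  rename : ∀ {m n} → (Fin m → Fin n) → Term m → Term n
  rename ρ (var i) = var (ρ i)
  rename ρ (app t u) = app (rename ρ t) (rename ρ u)
  rename ρ (lam t) = lam (rename (λ { zero → zero ; (suc i) → suc (ρ i) }) t)
  rename ρ cc = cc
  rename ρ (kk π) = kk π
  rename ρ (ins x) = ins x

  subst : ∀ {m n} → (Fin m → Term n) → Term m → Term n
  subst σ (var i) = σ i
  subst σ (app t u) = app (subst σ t) (subst σ u)
  subst σ (lam t) = lam (subst (λ { zero → var zero ; (suc i) → rename suc (σ i) }) t)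
  subst σ cc = cc
  subst σ (kk π) = kk π
  subst σ (ins x) = ins x

  _[0:=_] : Term 1 → Λ → Λ
  t [0:= s ] = subst (λ _ → s) t

  -- realizers: terms with no continuation constant
  data NoK : ∀ {n} → Term n → Set where
    var : ∀ {n} (i : Fin n) → NoK (var i)
    app : ∀ {n} {t u : Term n} → NoK t → NoK u → NoK (app t u)
    lam : ∀ {n} {t : Term (suc n)} → NoK t → NoK (lam t)
    cc  : ∀ {n} → NoK {n} cc
    ins : ∀ {n} (x : Inst) → NoK {n} (ins x)

  Proc : Set
  Proc = Λ × Π

  record RealAlg : Set₁ where
    field
      _≻_       : Proc → Proc → Set
      ≻-refl    : ∀ p → p ≻ p
      ≻-trans   : ∀ {p q r} → p ≻ q → q ≻ r → p ≻ r
      ≻-push    : ∀ t s π → (app t s , π) ≻ (t , s ∙ π)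
      ≻-grab    : ∀ (t : Term 1) s π → (lam t , s ∙ π) ≻ (t [0:= s ] , π)
      ≻-save    : ∀ t π → (cc , t ∙ π) ≻ (t , kk π ∙ π)
      ≻-restore : ∀ σ t π → (kk σ , t ∙ π) ≻ (t , σ)
      pole      : Proc → Set
      pole-anti : ∀ {p q} → p ≻ q → pole q → pole p

  church0 : Λ
  church0 = lam (lam (var zero))

  church1 : Λ
  church1 = lam (lam (app (var (suc zero)) (var zero)))

  θ : Λ
  θ = lam (lam (app (var zero) (var (suc zero))))

  -- Names: sets of pairs (name, stack), with extensional equality
  -- ("the same set") and membership.

  data Name : Set₁ where
    sup : (I : Set) → (I → Name × Π) → Name

  NIdx : Name → Set
  NIdx (sup I _) = I

  Nelt : (c : Name) → NIdx c → Name × Π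
  Nelt (sup _ f) = f

  _≈N_ : Name → Name → Set
  sup I f ≈N sup J g =
    ((i : I) → Σ J λ j → (proj₁ (f i) ≈N proj₁ (g j)) × (proj₂ (f i) ≡ proj₂ (g j)))
    × ((j : J) → Σ I λ i → (proj₁ (f i) ≈N proj₁ (g j)) × (proj₂ (f i) ≡ proj₂ (g j)))

  _∈N_ : Name × Π → Name → Set
  (c , π) ∈N sup I f = Σ I λ i → (proj₁ (f i) ≈N c) × (proj₂ (f i) ≡ π)

  reish : V → Name
  reish (sup I f) = sup (I × Π) (λ p → reish (f (proj₁ p)) , proj₂ p)

  sng : Name → Name
  sng a = sup Π (λ π → a , π)

  up : Name → Name → Name
  up a b = sup (Bool × Π) λ { (false , π) → a , church0 ∙ π
                            ; (true , π) → b , church1 ∙ π }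

  op : Name → Name → Name
  op a b = up (up (sng a) (reish emptyV)) (sng (sng b))

  fhat : (a : V) → (Idx a → V) → Name
  fhat a F = sup (Idx a × Π)
    (λ p → op (reish (elt a (proj₁ p))) (reish (F (proj₁ p))) , proj₂ p)

  -- Formulas, identified with their falsity values ‖φ‖ ⊆ Π.

  Fm : Set₂
  Fm = Π → Set₁

  ⊥' : Fm
  ⊥' _ = Lift _ ⊤

  _∉_ : Name → Name → Fm
  (a ∉ b) π = Lift _ ((a , π) ∈N b)

  _≠_ : Name → Name → Fm
  (a ≠ b) π = Lift _ (a ≈N b)

  ∀' : (Name → Fm) → Fm
  ∀' φ π = Σ Name λ a → φ a π

  ∀^ : Name → (Name → Fm) → Fm
  ∀^ c φ π = Σ (NIdx c) λ i → φ (proj₁ (Nelt c i)) π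

  module Real (A : RealAlg) where
    open RealAlg A

    infix 2 _⊩_
    infixr 4 _⇒_

    _⊩_ : Λ → Fm → Set₁
    t ⊩ φ = (π : Π) → φ π → pole (t , π)

    _⇒_ : Fm → Fm → Fm
    (φ ⇒ ψ) ρ = Σ Λ λ t → Σ Π λ π → Lift (lsuc Level.zero) (ρ ≡ t ∙ π) × (t ⊩ φ) × ψ π

    Realized : Fm → Set₁
    Realized φ = Σ Λ λ t → NoK t × (t ⊩ φ)

    ¬' : Fm → Fm
    ¬' φ = φ ⇒ ⊥'

    _ε_ : Name → Name → Fm
    a ε b = (a ∉ b) ⇒ ⊥'

    _≐_ : Name → Name → Fm
    a ≐ b = (a ≠ b) ⇒ ⊥'

    _∧'_ : Fm → Fm → Fm
    φ ∧' ψ = (φ ⇒ (ψ ⇒ ⊥')) ⇒ ⊥'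

    ∃' : (Name → Fm) → Fm
    ∃' φ = ∀' (λ x → φ x ⇒ ⊥') ⇒ ⊥'

    ∀ε : Name → (Name → Fm) → Fm
    ∀ε c φ = ∀' (λ x → ¬' (φ x) ⇒ (x ∉ c))

    IsεFunction : Name → Name → Fm
    IsεFunction g c =
      ∀ε c (λ x → ∃' (λ y → op x y ε g))
      ∧' ∀ε c (λ x → ∀' (λ y → ∀' (λ y' →
            ((op x y ε g) ∧' (op x y' ε g)) ⇒ (y ≐ y'))))

{-# OPTIONS --safe #-}
module Submission where

-- f̂ is functional: op is injective and 𝔯 reflects equality (given any stack),
-- so (op x y , π), (op x y' , π') ∈ f̂ force y ≈ 𝔯 f(c) ≈ 𝔯 f(c') ≈ y' for
-- members c ≈ c' of a.  Then ‖y ≠ y'‖ is all of Π, so a realizer of y ≠ y'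
-- refutes op x y ∉ f̂, and θ turns a realizer of op x y ε f̂ into the required
-- contradiction.  For the ε-function property, totality on 𝔯(a) is realized by
-- θ (θ I), with the witness 𝔯 f(c) read off the stack, and uniqueness by the
-- contrapositive of the first part.

open import Defs
open import Data.Product using (_×_; Σ-syntax; _,_; proj₁; proj₂)
open import Data.Fin using (Fin; zero; suc)
open import Data.Unit using (tt)
open import Data.Bool using (false; true)
open import Level using (lift)
open import Relation.Binary.Bundles using (Setoid)
open import Relation.Binary.PropositionalEquality as Eq using (_≡_; refl; cong; cong₂)
import Relation.Binary.Reasoning.Setoid as SetoidReasoning

module Terms (Inst Bot : Set) where
  open K Inst Bot

  subst-rename : ∀ {m n k} {σ : Fin n → Term k} {ρ : Fin m → Fin n} {τ : Fin m → Term k} →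
                 (∀ i → σ (ρ i) ≡ τ i) → ∀ t → subst σ (rename ρ t) ≡ subst τ t
  subst-rename h (var i)   = h i
  subst-rename h (app t u) = cong₂ app (subst-rename h t) (subst-rename h u)
  subst-rename h (lam t)   = cong lam (subst-rename (λ { zero → refl ; (suc i) → cong (rename suc) (h i) }) t)
  subst-rename h cc        = refl
  subst-rename h (kk π)    = refl
  subst-rename h (ins x)   = refl

  subst-id : ∀ {n} {σ : Fin n → Term n} → (∀ i → σ i ≡ var i) → ∀ t → subst σ t ≡ t
  subst-id h (var i)   = h i
  subst-id h (app t u) = cong₂ app (subst-id h t) (subst-id h u)
  subst-id h (lam t)   = cong lam (subst-id (λ { zero → refl ; (suc i) → cong (rename suc) (h i) }) t)
  subst-id h cc        = refl
  subst-id h (kk π)    = refl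
  subst-id h (ins x)   = refl

  rename-suc-[0:=] : (t s : Λ) → rename suc t [0:= s ] ≡ t
  rename-suc-[0:=] t s = Eq.trans (subst-rename {τ = λ ()} (λ ()) t) (subst-id (λ ()) t)

  NoK-rename : ∀ {m n} {ρ : Fin m → Fin n} {t : Term m} → NoK t → NoK (rename ρ t)
  NoK-rename (var i)   = var _
  NoK-rename (app t u) = app (NoK-rename t) (NoK-rename u)
  NoK-rename (lam t)   = lam (NoK-rename t)
  NoK-rename cc        = cc
  NoK-rename (ins x)   = ins x

  Iₜ : Λ
  Iₜ = lam (var zero)

  -- θ itself, usable under binders; θₙ {0} is θ by definition.
  θₙ : ∀ {n} → Term n
  θₙ = lam (lam (app (var zero) (var (suc zero))))

  pair : Λ → Λ → Λ
  pair t s = lam (app (app (var zero) (rename suc t)) (rename suc s))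

  -- λp.λr. p (λs. θ (θ r s))
  refute : Λ
  refute = lam (lam (app (var (suc zero)) (lam (app θₙ (app (app θₙ (var (suc zero))) (var zero))))))

  θₙ-NoK : ∀ {n} → NoK {n} θₙ
  θₙ-NoK = lam (lam (app (var zero) (var (suc zero))))

  pair-NoK : ∀ {t s} → NoK t → NoK s → NoK (pair t s)
  pair-NoK t s = lam (app (app (var zero) (NoK-rename t)) (NoK-rename s))

  refute-NoK : NoK refute
  refute-NoK = lam (lam (app (var (suc zero)) (lam (app θₙ-NoK (app (app θₙ-NoK (var (suc zero))) (var zero))))))

  εFunction-realizer : Λ
  εFunction-realizer = pair (app θ (app θ Iₜ)) (app θ refute)

  εFunction-realizer-NoK : NoK εFunction-realizer
  εFunction-realizer-NoK = pair-NoK (app θₙ-NoK (app θₙ-NoK (lam (var zero)))) (app θₙ-NoK refute-NoK)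

module Names (Inst Bot : Set) where
  open K Inst Bot

  ≈N-refl : ∀ {a} → a ≈N a
  ≈N-refl {sup I f} = (λ i → i , ≈N-refl , refl) , (λ i → i , ≈N-refl , refl)

  ≈N-sym : ∀ {a b} → a ≈N b → b ≈N a
  ≈N-sym {sup I f} {sup J g} (fwd , bwd) =
    (λ j → let (i , e , q) = bwd j in i , ≈N-sym e , Eq.sym q) ,
    (λ i → let (j , e , q) = fwd i in j , ≈N-sym e , Eq.sym q)

  ≈N-trans : ∀ {a b c} → a ≈N b → b ≈N c → a ≈N c
  ≈N-trans {sup I f} {sup J g} {sup K h} (fwd , bwd) (fwd' , bwd') =
    (λ i → let (j , e , q) = fwd i ; (k , e' , q') = fwd' j in k , ≈N-trans e e' , Eq.trans q q') ,
    (λ k → let (j , e' , q') = bwd' k ; (i , e , q) = bwd j in i , ≈N-trans e e' , Eq.trans q q')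

  ≈N-setoid : Setoid _ _
  ≈N-setoid = record
    { Carrier = Name ; _≈_ = _≈N_
    ; isEquivalence = record { refl = ≈N-refl ; sym = ≈N-sym ; trans = ≈N-trans } }

  reish-cong : ∀ {u v} → u ≈V v → reish u ≈N reish v
  reish-cong {sup I f} {sup J g} (fwd , bwd) =
    (λ (i , π) → let (j , e) = fwd i in (j , π) , reish-cong e , refl) ,
    (λ (j , π) → let (i , e) = bwd j in (i , π) , reish-cong e , refl)

  reish-injective : Π → ∀ {u v} → reish u ≈N reish v → u ≈V v
  reish-injective π {sup I f} {sup J g} (fwd , bwd) =
    (λ i → let ((j , _) , e , _) = fwd (i , π) in j , reish-injective π e) ,
    (λ j → let ((i , _) , e , _) = bwd (j , π) in i , reish-injective π e)

  sng-cong : ∀ {a a'} → a ≈N a' → sng a ≈N sng a'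
  sng-cong e = (λ π → π , e , refl) , (λ π → π , e , refl)

  up-cong : ∀ {a a' b b'} → a ≈N a' → b ≈N b' → up a b ≈N up a' b'
  up-cong e e' = (λ { (false , π) → (false , π) , e , refl ; (true , π) → (true , π) , e' , refl })
                , (λ { (false , π) → (false , π) , e , refl ; (true , π) → (true , π) , e' , refl })

  op-cong : ∀ {a a' b b'} → a ≈N a' → b ≈N b' → op a b ≈N op a' b'
  op-cong e e' = up-cong (up-cong (sng-cong e) ≈N-refl) (sng-cong (sng-cong e'))

  -- A stack is needed: if Π is empty, sng a is the empty name for every a.
  sng-injective : Π → ∀ {a a'} → sng a ≈N sng a' → a ≈N a'
  sng-injective π (fwd , _) = let (_ , e , _) = fwd π in e

  up-injectiveˡ : Π → ∀ {a a' b b'} → up a b ≈N up a' b' → a ≈N a'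
  up-injectiveˡ π (fwd , _) with fwd (false , π)
  ... | (false , _) , e , _ = e
  ... | (true , _) , _ , ()

  up-injectiveʳ : Π → ∀ {a a' b b'} → up a b ≈N up a' b' → b ≈N b'
  up-injectiveʳ π (fwd , _) with fwd (true , π)
  ... | (false , _) , _ , ()
  ... | (true , _) , e , _ = e

  op-injective : Π → ∀ {a a' b b'} → op a b ≈N op a' b' → a ≈N a' × b ≈N b'
  op-injective π e = sng-injective π (up-injectiveˡ π (up-injectiveˡ π e))
                   , sng-injective π (sng-injective π (up-injectiveʳ π e))

  fhat-total : ∀ a (f : Idx a → V) {x π} → (x , π) ∈N reish a →
               Σ[ y ∈ Name ] (∀ π' → (op x y , π') ∈N fhat a f)
  fhat-total (sup I F) f ((k , _) , e , _) = reish (f k) , λ π' → (k , π') , op-cong e ≈N-refl , refl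

  fhat-functional : ∀ a (f : Idx a → V) → (∀ i j → elt a i ≈V elt a j → f i ≈V f j) →
                    ∀ {x y y' π π'} → (op x y , π) ∈N fhat a f → (op x y' , π') ∈N fhat a f → y ≈N y'
  fhat-functional a f resp {y = y} {y' = y'} {π = π} ((k , _) , e , _) ((k' , _) , e' , _) = begin
    y              ≈⟨ ≈N-sym (proj₂ (op-injective π e)) ⟩
    reish (f k)    ≈⟨ reish-cong (resp k k' (reish-injective π same-argument)) ⟩
    reish (f k')   ≈⟨ proj₂ (op-injective π e') ⟩
    y'             ∎
    where
    open SetoidReasoning ≈N-setoid
    same-argument : reish (elt a k) ≈N reish (elt a k')
    same-argument = ≈N-trans (proj₁ (op-injective π e)) (≈N-sym (proj₁ (op-injective π e')))

module Realizability (Inst Bot : Set) (A : K.RealAlg Inst Bot) where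
  open K Inst Bot
  open RealAlg A
  open Real A
  open Terms Inst Bot
  open Names Inst Bot

  ⊩-app : ∀ {t s φ ψ} → t ⊩ φ ⇒ ψ → s ⊩ φ → app t s ⊩ ψ
  ⊩-app {t} {s} tR sR π p = pole-anti (≻-push t s π) (tR (s ∙ π) (s , π , lift refl , sR , p))

  ⊩-lam : ∀ {t φ ψ} → (∀ s → s ⊩ φ → t [0:= s ] ⊩ ψ) → lam t ⊩ φ ⇒ ψ
  ⊩-lam {t} h .(s ∙ π) (s , π , lift refl , sR , p) = pole-anti (≻-grab t s π) (h s sR π p)

  ∀-intro : ∀ {t φ} → (∀ a → t ⊩ φ a) → t ⊩ ∀' φ
  ∀-intro h π (a , p) = h a π p

  ∀^-intro : ∀ {t c φ} → (∀ a → t ⊩ φ a) → t ⊩ ∀^ c φ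
  ∀^-intro h π (i , p) = h _ π p

  ∀-elim : ∀ {t φ} a → t ⊩ ∀' φ → t ⊩ φ a
  ∀-elim a tR π p = tR π (a , p)

  θ-⊩ : ∀ {φ ψ} → θ ⊩ φ ⇒ (φ ⇒ ψ) ⇒ ψ
  θ-⊩ {ψ = ψ} = ⊩-lam λ t tR → ⊩-lam λ s sR →
    Eq.subst (λ u → app s u ⊩ ψ) (Eq.sym (rename-suc-[0:=] t s)) (⊩-app sR tR)

  ∃-intro : ∀ {t φ} a → t ⊩ φ a → app θ t ⊩ ∃' φ
  ∃-intro a tR .(s ∙ π) (s , π , lift refl , sR , p) =
    ⊩-app θ-⊩ tR (s ∙ π) (s , π , lift refl , ∀-elim a sR , p)

  ∀ε-intro : ∀ {t c φ} → (∀ x π → (x , π) ∈N c → t ⊩ φ x) → app θ t ⊩ ∀ε c φ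
  ∀ε-intro h .(s ∙ π) (x , s , π , lift refl , sR , lift m) =
    ⊩-app θ-⊩ (h x π m) (s ∙ π) (s , π , lift refl , sR , lift tt)

  ∧-intro : ∀ {t s φ ψ} → t ⊩ φ → s ⊩ ψ → pair t s ⊩ φ ∧' ψ
  ∧-intro {t} {s} tR sR = ⊩-lam λ z zR →
    Eq.subst₂ (λ u v → app (app z u) v ⊩ ⊥') (Eq.sym (rename-suc-[0:=] t z)) (Eq.sym (rename-suc-[0:=] s z))
      (⊩-app (⊩-app zR tR) sR)

  Iₜ-⊩-ε : ∀ {a b} → (∀ π → (a , π) ∈N b) → Iₜ ⊩ a ε b
  Iₜ-⊩-ε a∈b = ⊩-lam λ r rR π _ → rR π (lift (a∈b π))

  refute-⊩ : ∀ {ρ φ ψ} → θ ⊩ ρ ⇒ (φ ⇒ ψ) → refute ⊩ (φ ∧' ¬' ψ) ⇒ ¬' ρ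
  refute-⊩ {ρ} {φ} {ψ} θR = ⊩-lam λ p pR → ⊩-lam λ r rR →
    ⊩-app (Eq.subst (_⊩ (φ ⇒ ¬' ψ ⇒ ⊥') ⇒ ⊥') (Eq.sym (rename-suc-[0:=] p r)) pR)
          (⊩-lam λ s sR → Eq.subst (λ u → app θ (app (app θ u) s) ⊩ ¬' ψ ⇒ ⊥') (Eq.sym (rename-suc-[0:=] r s))
            (⊩-app θ-⊩ (⊩-app (⊩-app θR rR) sR)))

  module _ (a : V) (f : Idx a → V) (resp : ∀ i j → elt a i ≈V elt a j → f i ≈V f j) where

    fhat-unique : ∀ x y y' → θ ⊩ (y ≠ y') ⇒ ((op x y ε fhat a f) ⇒ (op x y' ∉ fhat a f))
    fhat-unique x y y' .(r ∙ s ∙ π) (r , _ , lift refl , rR , s , π , lift refl , sR , lift m') =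
      θ-⊩ (r ∙ s ∙ π) (r , s ∙ π , lift refl , r-refutes , s , π , lift refl , sR , lift tt)
      where
      r-refutes : r ⊩ op x y ∉ fhat a f
      r-refutes σ (lift m) = rR σ (lift (fhat-functional a f resp m m'))

    fhat-isεFunction : εFunction-realizer ⊩ IsεFunction (fhat a f) (reish a)
    fhat-isεFunction = ∧-intro
      (∀ε-intro λ _ _ x∈a → let (y , xy∈f) = fhat-total a f x∈a in ∃-intro y (Iₜ-⊩-ε xy∈f))
      (∀ε-intro λ x _ _ → ∀-intro λ y → ∀-intro λ y' → refute-⊩ (fhat-unique x y y'))

proposition16p3 : (Inst Bot : Set) → let open K Inst Bot in
    (A : RealAlg) → let open Real A in
    (a b : V) (f : Idx a → V) →
    -- f respects equality of the members of a (it is a function on a)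
    ((i j : Idx a) → elt a i ≈V elt a j → f i ≈V f j) →
    -- f takes values in b
    ((i : Idx a) → f i ∈V b) →
    (θ ⊩ ∀^ (reish a) (λ x → ∀' (λ y → ∀' (λ y' →
           (y ≠ y') ⇒ ((op x y ε fhat a f) ⇒ (op x y' ∉ fhat a f))))))
    × Realized (IsεFunction (fhat a f) (reish a))
proposition16p3 Inst Bot A a b f resp _ =
  ∀^-intro {c = reish a} (λ x → ∀-intro λ y → ∀-intro λ y' → fhat-unique a f resp x y y') ,
  εFunction-realizer , εFunction-realizer-NoK , fhat-isεFunction a f resp
  where
  open K Inst Bot
  open Terms Inst Bot
  open Realizability Inst Bot A
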